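{- Let $n$ be a positive integer, $f : \mathbb{Z}^n \to \mathbb{R}$ a function, and $$W_\pm = \{(x_1, \dots, x_n, x_{n+1}) \in \mathbb{Z}^{n+1} : \pm(x_{n+1} - f(x_1, \dots, x_n)) > 0\}.$$ Neither $W_+$ nor $W_-$ admits a minimal complement in $\mathbb{Z}^{n+1}$.
   Context: For an abelian group $G$ and nonempty subsets $W, W' \subseteq G$, $W'$ is a complement of $W$ in $G$ if $W + W' = G$; it is a minimal complement if moreover $W + (W' \setminus \{w'\}) \neq G$ for every $w' \in W'$. -}

module Defs where

open import Data.Nat using (ℕ)
open import Data.Integer using (ℤ; _+_; _≤_; _<_)
open import Data.Vec using (Vec; zipWith)
open import Data.Product using (_×_; _,_; Σ; ∃; ∃-syntax)
open import Relation.Binary.PropositionalEquality using (_≡_; _≢_)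
open import Relation.Nullary using (¬_)
open import Relation.Unary using (Pred)
open import Level using (0ℓ)

-- The group ℤ^(n+1), written as (x₁,…,xₙ) together with the last coordinate x_{n+1}.
Point : ℕ → Set
Point n = Vec ℤ n × ℤ

_⊕_ : ∀ {n} → Point n → Point n → Point n
(x , s) ⊕ (y , t) = zipWith _+_ x y , s + t

Subset : ℕ → Set₁
Subset n = Pred (Point n) 0ℓ

Nonempty : ∀ {n} → Subset n → Set
Nonempty W = ∃[ w ] W w

IsComplement : ∀ {n} → Subset n → Subset n → Set
IsComplement W W' = ∀ p → ∃[ w ] ∃[ w' ] (W w × W' w' × w ⊕ w' ≡ p)

Remove : ∀ {n} → Subset n → Point n → Subset n
Remove W' w' y = W' y × y ≢ w'

IsMinimalComplement : ∀ {n} → Subset n → Subset n → Set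
IsMinimalComplement W W' =
  Nonempty W' × IsComplement W W' ×
  (∀ w' → W' w' → ¬ IsComplement W (Remove W' w'))

-- W₊ = { (x , t) : t - f(x) > 0 } and W₋ = { (x , t) : t - f(x) < 0 }, where f : ℤⁿ → ℝ
-- is encoded through integer thresholds:
--   for W₊ : g x = ⌊f x⌋ + 1, so  t > f x  ⇔  g x ≤ t
--   for W₋ : h x = ⌈f x⌉ - 1, so  t < f x  ⇔  t ≤ h x
-- Every integer-valued g (resp. h) arises this way (take f = g - 1/2, resp. h + 1/2).
Wplus : ∀ {n} → (Vec ℤ n → ℤ) → Subset n
Wplus g (x , t) = g x ≤ t

Wminus : ∀ {n} → (Vec ℤ n → ℤ) → Subset n
Wminus h (x , t) = t ≤ h x

{-# OPTIONS --safe #-}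
module Submission where

-- W₊ is stable under the upward shifts (0, k), k ≥ 0, and moving any point far enough down
-- leaves W₊; W₋ is the mirror image. Let W' be a complement of such a W and u ∈ W'. Write p
-- shifted down by k as w + v with w ∈ W, v ∈ W'; then p = (w shifted up by k) + v. Choosing k
-- so that p − u shifted down by k is not in W forces v ≠ u, so W' ∖ {u} is still a complement.

open import Defs
open import Data.Nat using (ℕ; _≤_)
open import Data.Integer using (ℤ)
open import Data.Vec using (Vec)
open import Data.Product using (_×_)
open import Relation.Nullary using (¬_)

import Data.Integer.Properties as ℤ
open import Algebra.Properties.CommutativeSemigroup ℤ.+-commutativeSemigroup using (xy∙z≈xz∙y)
open import Algebra.Properties.AbelianGroup ℤ.+-0-abelianGroup using (//-rightDividesˡ; //-rightDividesʳ)
open import Data.Integer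
  using (0ℤ; 1ℤ; -1ℤ; _+_; _-_; -_; pred; nonNegative)
  renaming (_≤_ to _≤ℤ_; _<_ to _<ℤ_)
open import Data.Integer.Tactic.RingSolver using (solve-∀)
open import Data.Product using (_,_; ∃-syntax)
open import Data.Vec using ([]; _∷_; zipWith)
open import Level using (0ℓ)
open import Relation.Binary.PropositionalEquality
  using (_≡_; _≢_; refl; sym; cong; cong₂; subst; module ≡-Reasoning)
open import Relation.Nullary using (yes; no)
open import Relation.Unary using (Pred)

open ≡-Reasoning

shift : ∀ {n} → ℤ → Point n → Point n
shift k (x , t) = x , t + k

_⊖_ : ∀ {n} → Point n → Point n → Point n
(x , s) ⊖ (y , t) = zipWith _-_ x y , s - t

shift-⊕ : ∀ {n} k (p q : Point n) → shift k (p ⊕ q) ≡ shift k p ⊕ q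
shift-⊕ k (x , s) (y , t) = cong (zipWith _+_ x y ,_) (xy∙z≈xz∙y s t k)

shift-⊖ : ∀ {n} k (p q : Point n) → shift k p ⊖ q ≡ shift k (p ⊖ q)
shift-⊖ k (x , s) (y , t) = cong (zipWith _-_ x y ,_) (xy∙z≈xz∙y s k (- t))

shift-shift-neg : ∀ {n} k (p : Point n) → shift k (shift (- k) p) ≡ p
shift-shift-neg k (x , t) = cong (x ,_) (//-rightDividesˡ k t)

zipWith-x+y-y≡x : ∀ {n} (x y : Vec ℤ n) → zipWith _-_ (zipWith _+_ x y) y ≡ x
zipWith-x+y-y≡x []       []       = refl
zipWith-x+y-y≡x (a ∷ x) (b ∷ y) = cong₂ _∷_ (//-rightDividesʳ b a) (zipWith-x+y-y≡x x y)

p⊕q⊖q≡p : ∀ {n} (p q : Point n) → (p ⊕ q) ⊖ q ≡ p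
p⊕q⊖q≡p (x , s) (y , t) = cong₂ _,_ (zipWith-x+y-y≡x x y) (//-rightDividesʳ t s)

ShiftStable : ∀ {n} → Pred ℤ 0ℓ → Subset n → Set
ShiftStable K W = ∀ {k p} → K k → W p → W (shift k p)

ShiftEscaping : ∀ {n} → Pred ℤ 0ℓ → Subset n → Set
ShiftEscaping K W = ∀ p → ∃[ k ] (K k × ¬ W (shift (- k) p))

module _ {n} {W : Subset n} {K : Pred ℤ 0ℓ}
         (stable : ShiftStable K W) (escaping : ShiftEscaping K W) where

  Remove-isComplement : ∀ {W'} → IsComplement W W' → ∀ u → IsComplement W (Remove W' u)
  Remove-isComplement cover u p with escaping (p ⊖ u)
  ... | k , k∈K , p⊖u-k∉W with cover (shift (- k) p)
  ... | w , v , w∈W , v∈W' , w⊕v≡p-k =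
    shift k w , v , stable k∈K w∈W , (v∈W' , v≢u) , shifted-sum
    where
    shifted-sum : shift k w ⊕ v ≡ p
    shifted-sum = begin
      shift k w ⊕ v            ≡⟨ shift-⊕ k w v ⟨
      shift k (w ⊕ v)          ≡⟨ cong (shift k) w⊕v≡p-k ⟩
      shift k (shift (- k) p)  ≡⟨ shift-shift-neg k p ⟩
      p                        ∎

    v≢u : v ≢ u
    v≢u refl = p⊖u-k∉W (subst W w≡p⊖u-k w∈W)
      where
      w≡p⊖u-k : w ≡ shift (- k) (p ⊖ u)
      w≡p⊖u-k = begin
        w                     ≡⟨ p⊕q⊖q≡p w u ⟨
        (w ⊕ u) ⊖ u           ≡⟨ cong (_⊖ u) w⊕v≡p-k ⟩
        shift (- k) p ⊖ u     ≡⟨ shift-⊖ (- k) p u ⟩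
        shift (- k) (p ⊖ u)   ∎

  ¬IsMinimalComplement : ∀ W' → ¬ IsMinimalComplement W W'
  ¬IsMinimalComplement W' ((u , u∈W') , cover , minimal) =
    minimal u u∈W' (Remove-isComplement cover u)

Wplus-shiftStable : ∀ {n} (g : Vec ℤ n → ℤ) → ShiftStable (0ℤ ≤ℤ_) (Wplus g)
Wplus-shiftStable g {k} {x , t} 0≤k gx≤t = ℤ.≤-trans gx≤t (ℤ.i≤i+j t k ⦃ nonNegative 0≤k ⦄)

Wminus-shiftStable : ∀ {n} (h : Vec ℤ n → ℤ) → ShiftStable (_≤ℤ 0ℤ) (Wminus h)
Wminus-shiftStable h {k} {x , t} k≤0 t≤hx =
  subst (t + k ≤ℤ_) (ℤ.+-identityʳ (h x)) (ℤ.+-mono-≤ t≤hx k≤0)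

Wplus-shiftEscaping : ∀ {n} (g : Vec ℤ n → ℤ) → ShiftEscaping (0ℤ ≤ℤ_) (Wplus g)
Wplus-shiftEscaping g (x , t) with g x ℤ.≤? t
... | no gx≰t = 0ℤ , ℤ.≤-refl , λ gx≤t+0 → gx≰t (subst (g x ≤ℤ_) (ℤ.+-identityʳ t) gx≤t+0)
... | yes gx≤t =
  1ℤ + (t - g x) , ℤ.≤-trans (ℤ.i≤j⇒0≤j-i gx≤t) (ℤ.i≤suc[i] _) ,
  ℤ.<⇒≱ (subst (_<ℤ g x) (sym (t-[1+t-a]≡a-1 (g x) t)) (ℤ.i≤pred[j]⇒i<j ℤ.≤-refl))
  where
  t-[1+t-a]≡a-1 : ∀ a t → t - (1ℤ + (t - a)) ≡ -1ℤ + a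
  t-[1+t-a]≡a-1 = solve-∀

Wminus-shiftEscaping : ∀ {n} (h : Vec ℤ n → ℤ) → ShiftEscaping (_≤ℤ 0ℤ) (Wminus h)
Wminus-shiftEscaping h (x , t) with t ℤ.≤? h x
... | no t≰hx = 0ℤ , ℤ.≤-refl , λ t+0≤hx → t≰hx (subst (_≤ℤ h x) (ℤ.+-identityʳ t) t+0≤hx)
... | yes t≤hx =
  pred (t - h x) , ℤ.i≤j⇒pred[i]≤j (ℤ.i≤j⇒i-j≤0 t≤hx) ,
  ℤ.<⇒≱ (subst (h x <ℤ_) (sym (t-[t-a-1]≡a+1 (h x) t)) (ℤ.suc[i]≤j⇒i<j ℤ.≤-refl))
  where
  t-[t-a-1]≡a+1 : ∀ a t → t - (-1ℤ + (t - a)) ≡ 1ℤ + a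
  t-[t-a-1]≡a+1 = solve-∀

corollary3p10 : (n : ℕ) → 1 ≤ n → (g h : Vec ℤ n → ℤ) →
    ((W' : Subset n) → ¬ IsMinimalComplement (Wplus g) W') ×
    ((W' : Subset n) → ¬ IsMinimalComplement (Wminus h) W')
corollary3p10 n _ g h =
  ¬IsMinimalComplement (Wplus-shiftStable g) (Wplus-shiftEscaping g) ,
  ¬IsMinimalComplement (Wminus-shiftStable h) (Wminus-shiftEscaping h)
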